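{- Let $\Delta\in\mathcal{B}$, $\gamma\in\Gamma^b_\Delta$ and $j\in J_\Delta$. Then $\lambda_{\gamma,j,\Delta}\neq1$.
   Context: $P\subset\mathbb{R}^d$ is a compact convex simple $d$-dimensional polytope with vertices in $\mathbb{Z}^d$ and facets $F_1,\dots,F_N$; $\mathbb{R}^d$ is identified with its dual via the standard inner product. For each $i$, $\eta_i\in\mathbb{Z}^d$ is the primitive inward normal vector to $F_i$. $\mathcal{B}$ is the set of affine spans of the nonempty faces of $P$ (including $\mathbb{R}^d$). For $\Delta\in\mathcal{B}$ let $J_\Delta=\{i:\Delta\subset\mathrm{aff}(F_i)\}$, $V_\Delta=\mathrm{span}_{\mathbb{R}}\{\eta_i:i\in J_\Delta\}$, and let $\{\alpha_{\Delta,j}\}_{j\in J_\Delta}$ be the basis of $V_\Delta$ dual to $\{\eta_i\}_{i\in J_\Delta}$, i.e. $\langle\alpha_{\Delta,j},\eta_l\rangle=\delta_{jl}$. Define $\Gamma_\Delta=(\mathbb{Z}^d\cap V_\Delta)/\sum_{i\in J_\Delta}\mathbb{Z}\eta_i$. If $\Delta\subset\tilde\Delta$ in $\mathcal{B}$, inclusion $V_{\tilde\Delta}\subset V_\Delta$ induces an injective homomorphism $\Gamma_{\tilde\Delta}\to\Gamma_\Delta$, by which $\Gamma_{\tilde\Delta}$ is regarded as a subgroup of $\Gamma_\Delta$. Set $\Gamma^b_\Delta=\Gamma_\Delta\setminus\bigcup_{\tilde\Delta\in\mathcal{B},\ \Delta\subsetneq\tilde\Delta}\Gamma_{\tilde\Delta}$.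 For $\gamma\in\Gamma_\Delta$ with representative $\tilde\gamma\in\mathbb{Z}^d\cap V_\Delta$ and $j\in J_\Delta$, set $\lambda_{\gamma,j,\Delta}=e^{2\pi i\langle\tilde\gamma,\alpha_{\Delta,j}\rangle}$ (independent of the representative). -}

module Defs where

open import Data.Nat using (ℕ; zero; suc)
open import Data.Integer as ℤ using (ℤ)
open import Data.Rational using (ℚ; _+_; _*_; _-_; _≤_; _<_; 0ℚ; 1ℚ; ∣_∣; _/_)
open import Data.Rational.Properties using (_≟_)
open import Data.Fin using (Fin; zero; suc)
open import Data.List using (List; []; _∷_; map; filter; length; allFin)
open import Data.List.Relation.Unary.All using (All)
open import Data.Product using (Σ; ∃; _×_; _,_; proj₁; proj₂)
open import Relation.Nullary using (¬_)
open import Relation.Binary.PropositionalEquality using (_≡_; _≢_; _≗_)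

-- Basic linear algebra over ℚ (all data in the paper is rational:
-- integer vertices and integer normals).

ℚ^_ : ℕ → Set
ℚ^ d = Fin d → ℚ

ℤ^_ : ℕ → Set
ℤ^ d = Fin d → ℤ

toℚ : ℤ → ℚ
toℚ z = z / 1

cast : ∀ {d} → ℤ^ d → ℚ^ d
cast z k = toℚ (z k)

∑ : ∀ {n} → (Fin n → ℚ) → ℚ
∑ {zero}  f = 0ℚ
∑ {suc n} f = f zero + ∑ (λ i → f (suc i))

_·_ : ∀ {d} → ℚ^ d → ℚ^ d → ℚ
u · v = ∑ (λ k → u k * v k)

sumList : List ℚ → ℚ
sumList []       = 0ℚ
sumList (q ∷ qs) = q + sumList qs

AffineSpan : ∀ {d} → (ℚ^ d → Set) → ℚ^ d → Set
AffineSpan {d} S y =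
  Σ (List (ℚ × ℚ^ d)) λ ps →
    All (λ p → S (proj₂ p)) ps
    × sumList (map proj₁ ps) ≡ 1ℚ
    × (y ≗ λ k → sumList (map (λ p → proj₁ p * proj₂ p k) ps))

IsInteger : ℚ → Set
IsInteger q = ∃ λ (k : ℤ) → q ≡ toℚ k

Primitive : ∀ {d} → ℤ^ d → Set
Primitive {d} v = ∀ (k : ℤ) (w : ℤ^ d) → (∀ m → v m ≡ k ℤ.* w m) → ℤ.∣ k ∣ ≡ 1

-- A compact convex simple d-dimensional lattice polytope with facets
-- F_1..F_N, given by its (irredundant) facet description
--   P = { x | ⟨η_i , x⟩ ≥ c_i  for all i },   F_i = P ∩ {⟨η_i,x⟩ = c_i}.

module PolytopeData {d N : ℕ} (η : Fin N → ℤ^ d) (c : Fin N → ℚ) where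

  InP : ℚ^ d → Set
  InP x = ∀ i → c i ≤ cast (η i) · x

  -- x lies on the hyperplane aff(F_i) = {⟨η_i,x⟩ = c_i}
  OnH : Fin N → ℚ^ d → Set
  OnH i x = cast (η i) · x ≡ c i

  Vertex : ℚ^ d → Set
  Vertex x = InP x × (∀ y → (∀ i → OnH i x → OnH i y) → y ≗ x)

  tightCount : ℚ^ d → ℕ
  tightCount x = length (filter (λ i → cast (η i) · x ≟ c i) (allFin N))

record LatticeSimplePolytope (d N : ℕ) : Set where
  field
    η : Fin N → ℤ^ d
    c : Fin N → ℚ
  open PolytopeData η c public
  field
    isPrimitive : ∀ i → Primitive (η i)
    bounded    : ∃ λ (M : ℚ) → ∀ x → InP x → ∀ k → ∣ x k ∣ ≤ M
    fullDim    : ∃ λ x → ∀ i → c i < cast (η i) · x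
    -- each F_i is a facet (has a relative interior point), so the F_i are
    -- pairwise distinct and are exactly the facets of P
    facet      : ∀ i → ∃ λ x → InP x × OnH i x × (∀ l → l ≢ i → c l < cast (η l) · x)
    latticeVertices : ∀ x → Vertex x → ∃ λ (z : ℤ^ d) → x ≗ cast z
    simple     : ∀ x → Vertex x → tightCount x ≡ d

-- Nonempty faces of P (including P itself: a = 0, b = 0) and the
-- objects B, J_Δ, V_Δ, Γ_Δ, Γ^b_Δ, α_{Δ,j}.

module _ {d N : ℕ} (P : LatticeSimplePolytope d N) where
  open LatticeSimplePolytope P

  record Face : Set where
    field
      a        : ℚ^ d
      b        : ℚ
      valid    : ∀ x → InP x → b ≤ a · x
      nonempty : ∃ λ x → InP x × a · x ≡ b

  InFace : Face → ℚ^ d → Set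
  InFace F x = InP x × Face.a F · x ≡ Face.b F

  Δ : Face → ℚ^ d → Set
  Δ F = AffineSpan (InFace F)

  J : Face → Fin N → Set
  J F i = ∀ y → Δ F y → OnH i y

  StrictSub : Face → Face → Set
  StrictSub F G = (∀ y → Δ F y → Δ G y) × ¬ (∀ y → Δ G y → Δ F y)

  InV : Face → ℚ^ d → Set
  InV F v = ∃ λ (r : Fin N → ℚ) →
    (∀ i → ¬ J F i → r i ≡ 0ℚ) × (v ≗ λ k → ∑ (λ i → r i * toℚ (η i k)))

  -- the class [γ] ∈ Γ_{Δ_F} lies in (the image of) Γ_{Δ_G}:
  -- γ − Σ_{i∈J_Δ} n_i η_i ∈ ℤ^d ∩ V_{Δ_G} for some integers n_i
  InImage : Face → Face → ℤ^ d → Set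
  InImage F G γ = ∃ λ (n : Fin N → ℤ) →
    (∀ i → ¬ J F i → n i ≡ ℤ.0ℤ)
    × InV G (λ k → toℚ (γ k) - ∑ (λ i → toℚ (n i) * toℚ (η i k)))

  -- γ ∈ ℤ^d ∩ V_Δ represents an element of Γ^b_Δ
  InΓb : Face → ℤ^ d → Set
  InΓb F γ = InV F (cast γ) × (∀ G → StrictSub F G → ¬ InImage F G γ)

  DualBasis : Face → (Fin N → ℚ^ d) → Set
  DualBasis F α =
    (∀ j → J F j → InV F (α j))
    × (∀ j l → J F j → J F l → j ≡ l → α j · cast (η l) ≡ 1ℚ)
    × (∀ j l → J F j → J F l → j ≢ l → α j · cast (η l) ≡ 0ℚ)

{-# OPTIONS --safe #-}
-- Suppose ⟨γ, α_j⟩ = k ∈ ℤ and write γ = Σ_{i ∈ J_Δ} sᵢ ηᵢ. Duality gives s_j = k, so γ − k η_j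
-- lies in the span of the ηᵢ with i ∈ J_Δ ∖ {j}. Starting from a relative interior point x₀ of
-- the face and moving a little in the direction α_j, one stays in P and on aff(Fᵢ) for
-- i ∈ J_Δ ∖ {j} but leaves aff(F_j). Hence the face G of P cut out by the facets in J_Δ ∖ {j}
-- has affine span strictly larger than Δ and J_{aff G} ⊇ J_Δ ∖ {j}, so [γ] = [γ − k η_j] lies
-- in Γ_{aff G}, contradicting γ ∈ Γ^b_Δ.
-- Decidability of i ∈ J_Δ and the relative interior point are only available under double
-- negation, which suffices because the goal is a negation.
module Submission where

open import Defs
open import Data.Nat using (ℕ; zero; suc)
open import Data.Fin using (Fin; zero; suc)
open import Data.Fin.Properties using (suc-injective) renaming (_≟_ to _≟ᶠ_)
open import Data.Integer as ℤ using (ℤ)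
open import Data.Rational
  using ( ℚ; _+_; _*_; _-_; -_; _≤_; _<_; _⊓_; 0ℚ; 1ℚ; ½; 1/_
        ; NonZero; Positive; NonNegative; positive; nonNegative; >-nonZero )
open import Data.Rational.Properties
open import Data.Rational.Solver using (module +-*-Solver)
open import Data.List using (List; []; _∷_; map)
open import Data.List.Relation.Unary.All as All using (All; []; _∷_)
open import Data.Product using (∃; _×_; _,_; proj₁; proj₂)
open import Data.Sum using ([_,_]′)
open import Function using (_∘_; id)
open import Relation.Nullary
  using (¬_; Dec; yes; no; ¬?; _×-dec_; ¬¬-excluded-middle; decidable-stable; contradiction)
open import Relation.Nullary.Negation using (¬¬-map)
open import Relation.Binary.PropositionalEquality
  using (_≡_; _≢_; _≗_; refl; sym; trans; cong; cong₂; subst; module ≡-Reasoning)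
open +-*-Solver

∑-cong : ∀ {n} {f g : Fin n → ℚ} → (∀ i → f i ≡ g i) → ∑ f ≡ ∑ g
∑-cong {zero}  f≗g = refl
∑-cong {suc n} f≗g = cong₂ _+_ (f≗g zero) (∑-cong (f≗g ∘ suc))

∑-zero : ∀ {n} {f : Fin n → ℚ} → (∀ i → f i ≡ 0ℚ) → ∑ f ≡ 0ℚ
∑-zero {zero}  f≗0 = refl
∑-zero {suc n} f≗0 = trans (cong₂ _+_ (f≗0 zero) (∑-zero (f≗0 ∘ suc))) (+-identityˡ 0ℚ)

∑-single : ∀ {n} (f : Fin n → ℚ) (j : Fin n) → (∀ i → i ≢ j → f i ≡ 0ℚ) → ∑ f ≡ f j
∑-single {suc n} f zero    f≗0 =
  trans (cong (f zero +_) (∑-zero (λ i → f≗0 (suc i) λ ()))) (+-identityʳ (f zero))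
∑-single {suc n} f (suc j) f≗0 =
  trans (cong₂ _+_ (f≗0 zero λ ()) (∑-single (f ∘ suc) j λ i i≢j → f≗0 (suc i) (i≢j ∘ suc-injective)))
        (+-identityˡ (f (suc j)))

∑-distrib-+ : ∀ {n} (f g : Fin n → ℚ) → ∑ (λ i → f i + g i) ≡ ∑ f + ∑ g
∑-distrib-+ {zero}  f g = refl
∑-distrib-+ {suc n} f g =
  trans (cong (f zero + g zero +_) (∑-distrib-+ (f ∘ suc) (g ∘ suc)))
        (solve 4 (λ a b c e → a :+ b :+ (c :+ e) := a :+ c :+ (b :+ e)) refl (f zero) (g zero) _ _)

∑-distrib-- : ∀ {n} (f g : Fin n → ℚ) → ∑ (λ i → f i - g i) ≡ ∑ f - ∑ g
∑-distrib-- {zero}  f g = refl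
∑-distrib-- {suc n} f g =
  trans (cong (f zero - g zero +_) (∑-distrib-- (f ∘ suc) (g ∘ suc)))
        (solve 4 (λ a b c e → a :- b :+ (c :- e) := a :+ c :- (b :+ e)) refl (f zero) (g zero) _ _)

*-distribˡ-∑ : ∀ {n} (p : ℚ) (f : Fin n → ℚ) → p * ∑ f ≡ ∑ (λ i → p * f i)
*-distribˡ-∑ {zero}  p f = *-zeroʳ p
*-distribˡ-∑ {suc n} p f =
  trans (*-distribˡ-+ p (f zero) _) (cong (p * f zero +_) (*-distribˡ-∑ p (f ∘ suc)))

∑-comm : ∀ {m n} (f : Fin m → Fin n → ℚ) → ∑ (λ i → ∑ (f i)) ≡ ∑ (λ k → ∑ (λ i → f i k))
∑-comm {zero} {n} f = sym (∑-zero {n} (λ _ → refl))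
∑-comm {suc m} f = trans (cong (∑ (f zero) +_) (∑-comm (f ∘ suc))) (sym (∑-distrib-+ (f zero) _))

∑-mono-≤ : ∀ {n} {f g : Fin n → ℚ} → (∀ i → f i ≤ g i) → ∑ f ≤ ∑ g
∑-mono-≤ {zero}  f≤g = ≤-refl
∑-mono-≤ {suc n} f≤g = +-mono-≤ (f≤g zero) (∑-mono-≤ (f≤g ∘ suc))

+-mono-≤-equality : ∀ {p q r s} → p ≤ q → r ≤ s → p + r ≡ q + s → p ≡ q × r ≡ s
+-mono-≤-equality p≤q r≤s eq =
    ≤-antisym p≤q (≮⇒≥ λ q<p → <-irrefl eq (+-mono-<-≤ q<p r≤s))
  , ≤-antisym r≤s (≮⇒≥ λ s<r → <-irrefl eq (+-mono-≤-< p≤q s<r))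

∑-mono-≤-equality : ∀ {n} {f g : Fin n → ℚ} → (∀ i → f i ≤ g i) → ∑ f ≡ ∑ g → ∀ i → f i ≡ g i
∑-mono-≤-equality {suc n} {f} {g} f≤g eq = λ
  { zero    → proj₁ head-and-tail
  ; (suc i) → ∑-mono-≤-equality (f≤g ∘ suc) (proj₂ head-and-tail) i }
  where
  head-and-tail : f zero ≡ g zero × ∑ (f ∘ suc) ≡ ∑ (g ∘ suc)
  head-and-tail = +-mono-≤-equality (f≤g zero) (∑-mono-≤ (f≤g ∘ suc)) eq

infixl 6 _+ᵛ_
infixl 7 _*ᵛ_

_+ᵛ_ : ∀ {d} → ℚ^ d → ℚ^ d → ℚ^ d
(x +ᵛ y) k = x k + y k

_*ᵛ_ : ∀ {d} → ℚ → ℚ^ d → ℚ^ d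
(p *ᵛ x) k = p * x k

linearCombination : ∀ {d n} → (Fin n → ℚ) → (Fin n → ℚ^ d) → ℚ^ d
linearCombination r v k = ∑ (λ i → r i * v i k)

midpoint : ∀ {d} → ℚ^ d → ℚ^ d → ℚ^ d
midpoint x y = ½ *ᵛ (x +ᵛ y)

·-comm : ∀ {d} (x y : ℚ^ d) → x · y ≡ y · x
·-comm x y = ∑-cong (λ k → *-comm (x k) (y k))

·-congʳ : ∀ {d} (h : ℚ^ d) {x y : ℚ^ d} → x ≗ y → h · x ≡ h · y
·-congʳ h x≗y = ∑-cong (λ k → cong (h k *_) (x≗y k))

·-congˡ : ∀ {d} (h : ℚ^ d) {x y : ℚ^ d} → x ≗ y → x · h ≡ y · h
·-congˡ h x≗y = ∑-cong (λ k → cong (_* h k) (x≗y k))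

·-distribˡ-+ᵛ : ∀ {d} (h x y : ℚ^ d) → h · (x +ᵛ y) ≡ h · x + h · y
·-distribˡ-+ᵛ h x y =
  trans (∑-cong (λ k → *-distribˡ-+ (h k) (x k) (y k))) (∑-distrib-+ (λ k → h k * x k) (λ k → h k * y k))

·-*ᵛ : ∀ {d} (h : ℚ^ d) (p : ℚ) (x : ℚ^ d) → h · (p *ᵛ x) ≡ p * (h · x)
·-*ᵛ h p x =
  trans (∑-cong (λ k → solve 3 (λ a b c → a :* (b :* c) := b :* (a :* c)) refl (h k) p (x k)))
        (sym (*-distribˡ-∑ p (λ k → h k * x k)))

·-midpoint : ∀ {d} (h x y : ℚ^ d) → h · midpoint x y ≡ ½ * (h · x + h · y)
·-midpoint h x y = trans (·-*ᵛ h ½ (x +ᵛ y)) (cong (½ *_) (·-distribˡ-+ᵛ h x y))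

linearCombination-· : ∀ {d n} (r : Fin n → ℚ) (v : Fin n → ℚ^ d) (x : ℚ^ d) →
                      linearCombination r v · x ≡ ∑ (λ i → r i * (v i · x))
linearCombination-· r v x = begin
  ∑ (λ k → ∑ (λ i → r i * v i k) * x k)   ≡⟨ ∑-cong (λ k → *-comm _ (x k)) ⟩
  ∑ (λ k → x k * ∑ (λ i → r i * v i k))   ≡⟨ ∑-cong (λ k → *-distribˡ-∑ (x k) (λ i → r i * v i k)) ⟩
  ∑ (λ k → ∑ (λ i → x k * (r i * v i k))) ≡⟨ ∑-comm (λ k i → x k * (r i * v i k)) ⟩
  ∑ (λ i → ∑ (λ k → x k * (r i * v i k))) ≡⟨ ∑-cong (λ i → ∑-cong (λ k → reassoc (x k) (r i) (v i k))) ⟩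
  ∑ (λ i → ∑ (λ k → r i * (v i k * x k))) ≡⟨ ∑-cong (λ i → sym (*-distribˡ-∑ (r i) (λ k → v i k * x k))) ⟩
  ∑ (λ i → r i * (v i · x))               ∎
  where
  open ≡-Reasoning
  reassoc : ∀ a b c → a * (b * c) ≡ b * (c * a)
  reassoc = solve 3 (λ a b c → a :* (b :* c) := b :* (c :* a)) refl

affineCombination : ∀ {d} → List (ℚ × ℚ^ d) → ℚ^ d
affineCombination ps k = sumList (map (λ p → proj₁ p * proj₂ p k) ps)

·-affineCombination : ∀ {d} (h : ℚ^ d) (c : ℚ) (ps : List (ℚ × ℚ^ d)) →
                      All (λ p → h · proj₂ p ≡ c) ps →
                      h · affineCombination ps ≡ sumList (map proj₁ ps) * c
·-affineCombination h c []             []              =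
  trans (∑-zero (λ k → *-zeroʳ (h k))) (sym (*-zeroˡ c))
·-affineCombination h c ((q , x) ∷ ps) (hx≡c ∷ hps≡c) = begin
  h · (q *ᵛ x +ᵛ affineCombination ps)       ≡⟨ ·-distribˡ-+ᵛ h (q *ᵛ x) (affineCombination ps) ⟩
  h · (q *ᵛ x) + h · affineCombination ps    ≡⟨ cong₂ _+_ (·-*ᵛ h q x) (·-affineCombination h c ps hps≡c) ⟩
  q * (h · x) + sumList (map proj₁ ps) * c   ≡⟨ cong (λ z → q * z + sumList (map proj₁ ps) * c) hx≡c ⟩
  q * c + sumList (map proj₁ ps) * c         ≡⟨ sym (*-distribʳ-+ c q (sumList (map proj₁ ps))) ⟩
  (q + sumList (map proj₁ ps)) * c           ∎
  where open ≡-Reasoning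

AffineSpan-⊇ : ∀ {d} {S : ℚ^ d → Set} {x : ℚ^ d} → S x → AffineSpan S x
AffineSpan-⊇ {x = x} x∈S =
  ((1ℚ , x) ∷ []) , (x∈S ∷ []) , refl , λ k → sym (trans (+-identityʳ _) (*-identityˡ (x k)))

AffineSpan-mono : ∀ {d} {S T : ℚ^ d → Set} → (∀ {x} → S x → T x) →
                  ∀ {y} → AffineSpan S y → AffineSpan T y
AffineSpan-mono S⊆T (ps , ps⊆S , ∑weights≡1 , y≗) = ps , All.map S⊆T ps⊆S , ∑weights≡1 , y≗

AffineSpan-⊆-hyperplane : ∀ {d} {S : ℚ^ d → Set} (h : ℚ^ d) (c : ℚ) →
                          (∀ {x} → S x → h · x ≡ c) → ∀ {y} → AffineSpan S y → h · y ≡ c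
AffineSpan-⊆-hyperplane h c S⊆H {y} (ps , ps⊆S , ∑weights≡1 , y≗) = begin
  h · y                            ≡⟨ ·-congʳ h y≗ ⟩
  h · affineCombination ps         ≡⟨ ·-affineCombination h c ps (All.map S⊆H ps⊆S) ⟩
  sumList (map proj₁ ps) * c       ≡⟨ cong (_* c) ∑weights≡1 ⟩
  1ℚ * c                           ≡⟨ *-identityˡ c ⟩
  c                                ∎
  where open ≡-Reasoning

≤∧≢⇒< : ∀ {p q : ℚ} → p ≤ q → p ≢ q → p < q
≤∧≢⇒< p≤q p≢q = ≰⇒> (p≢q ∘ ≤-antisym p≤q)

½*[p+p]≡p : ∀ p → ½ * (p + p) ≡ p
½*[p+p]≡p = solve 1 (λ p → con ½ :* (p :+ p) := p) refl

≤-midpoint : ∀ {p q r} → p ≤ q → p ≤ r → p ≤ ½ * (q + r)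
≤-midpoint {p} p≤q p≤r = subst (_≤ _) (½*[p+p]≡p p) (*-monoˡ-≤-nonNeg ½ (+-mono-≤ p≤q p≤r))

<-midpointˡ : ∀ {p q r} → p < q → p ≤ r → p < ½ * (q + r)
<-midpointˡ {p} p<q p≤r = subst (_< _) (½*[p+p]≡p p) (*-monoʳ-<-pos ½ (+-mono-<-≤ p<q p≤r))

<-midpointʳ : ∀ {p q r} → p ≤ q → p < r → p < ½ * (q + r)
<-midpointʳ {p} p≤q p<r = subst (_< _) (½*[p+p]≡p p) (*-monoʳ-<-pos ½ (+-mono-≤-< p≤q p<r))

p≤p+q*r : ∀ p {q r} → 0ℚ ≤ q → 0ℚ ≤ r → p ≤ p + q * r
p≤p+q*r p {q} {r} 0≤q 0≤r = begin
  p          ≡⟨ sym (+-identityʳ p) ⟩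
  p + 0ℚ     ≡⟨ cong (p +_) (sym (*-zeroˡ r)) ⟩
  p + 0ℚ * r ≤⟨ +-monoʳ-≤ p (*-monoʳ-≤-nonNeg r {{nonNegative 0≤r}} 0≤q) ⟩
  p + q * r  ∎
  where open ≤-Reasoning

HoldsNear0⁺ : (ℚ → Set) → Set
HoldsNear0⁺ Q = ∃ λ δ → 0ℚ < δ × (∀ e → 0ℚ ≤ e → e ≤ δ → Q e)

∀-HoldsNear0⁺ : ∀ {n} {Q : Fin n → ℚ → Set} →
                (∀ i → HoldsNear0⁺ (Q i)) → HoldsNear0⁺ (λ e → ∀ i → Q i e)
∀-HoldsNear0⁺ {zero}  near = 1ℚ , positive⁻¹ 1ℚ , λ _ _ _ ()
∀-HoldsNear0⁺ {suc n} near =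
  let δ , 0<δ , Q₀ = near zero
      ε , 0<ε , Qₛ = ∀-HoldsNear0⁺ (near ∘ suc)
  in  δ ⊓ ε
    , [ (λ ≡δ → subst (0ℚ <_) (sym ≡δ) 0<δ) , (λ ≡ε → subst (0ℚ <_) (sym ≡ε) 0<ε) ]′ (⊓-sel δ ε)
    , λ { e 0≤e e≤δ⊓ε zero    → Q₀ e 0≤e (≤-trans e≤δ⊓ε (p⊓q≤p δ ε))
        ; e 0≤e e≤δ⊓ε (suc i) → Qₛ e 0≤e (≤-trans e≤δ⊓ε (p⊓q≤q δ ε)) i }

<-robust : ∀ {c x} (t : ℚ) → c < x → HoldsNear0⁺ (λ e → c ≤ x + e * t)
<-robust {c} {x} t c<x with 0ℚ ≤? t
... | yes 0≤t = 1ℚ , positive⁻¹ 1ℚ , λ e 0≤e _ → ≤-trans (<⇒≤ c<x) (p≤p+q*r x 0≤e 0≤t)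
... | no  0≰t = δ , 0<δ , c≤x+e*t
  where
  0<-t : 0ℚ < - t
  0<-t = neg-antimono-< (≰⇒> 0≰t)
  instance
    -t≢0 : NonZero (- t)
    -t≢0 = >-nonZero 0<-t
    -t≥0 : NonNegative (- t)
    -t≥0 = nonNegative (<⇒≤ 0<-t)
    -t>0 : Positive (- t)
    -t>0 = positive 0<-t
    1/-t>0 : Positive (1/ (- t))
    1/-t>0 = 1/pos⇒pos (- t)
  -- the step at which c ≤ x + e * t becomes tight
  δ : ℚ
  δ = (x - c) * 1/ (- t)
  0<x-c : 0ℚ < x - c
  0<x-c = subst (_< x - c) (+-inverseʳ c) (+-monoˡ-< (- c) c<x)
  0<δ : 0ℚ < δ
  0<δ = subst (_< δ) (*-zeroˡ (1/ (- t))) (*-monoˡ-<-pos (1/ (- t)) 0<x-c)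
  δ*-t≡x-c : δ * (- t) ≡ x - c
  δ*-t≡x-c = trans (*-assoc (x - c) _ (- t))
                   (trans (cong ((x - c) *_) (*-inverseˡ (- t))) (*-identityʳ (x - c)))
  c≤x+e*t : ∀ e → 0ℚ ≤ e → e ≤ δ → c ≤ x + e * t
  c≤x+e*t e _ e≤δ = begin
    c                        ≡⟨ solve 3 (λ c e t → c := e :* (:- t) :+ (c :+ e :* t)) refl c e t ⟩
    e * (- t) + (c + e * t)  ≤⟨ +-monoˡ-≤ (c + e * t) e*-t≤x-c ⟩
    x - c + (c + e * t)      ≡⟨ solve 4 (λ c e t x → x :- c :+ (c :+ e :* t) := x :+ e :* t) refl c e t x ⟩
    x + e * t                ∎
    where
    open ≤-Reasoning
    e*-t≤x-c : e * (- t) ≤ x - c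
    e*-t≤x-c = subst (e * (- t) ≤_) δ*-t≡x-c (*-monoʳ-≤-nonNeg (- t) e≤δ)

¬¬-∀-Fin : ∀ {n} {P : Fin n → Set} → (∀ i → ¬ ¬ P i) → ¬ ¬ (∀ i → P i)
¬¬-∀-Fin {zero}  _   k = k λ ()
¬¬-∀-Fin {suc n} ¬¬P k =
  ¬¬P zero λ P₀ → ¬¬-∀-Fin (¬¬P ∘ suc) λ Pₛ → k λ { zero → P₀ ; (suc i) → Pₛ i }

indicator : ∀ {A : Set} → Dec A → ℚ
indicator (yes _) = 1ℚ
indicator (no _)  = 0ℚ

indicator-*-mono-≤ : ∀ {A : Set} (a? : Dec A) {p q} → p ≤ q → indicator a? * p ≤ indicator a? * q
indicator-*-mono-≤ (yes _) = *-monoˡ-≤-nonNeg 1ℚ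
indicator-*-mono-≤ (no _)  = *-monoˡ-≤-nonNeg 0ℚ

indicator-*-cong : ∀ {A : Set} (a? : Dec A) {p q} →
                   (A → p ≡ q) → indicator a? * p ≡ indicator a? * q
indicator-*-cong (yes a) p≡q = cong (1ℚ *_) (p≡q a)
indicator-*-cong (no _) {p} {q} _ = trans (*-zeroˡ p) (sym (*-zeroˡ q))

indicator-*-cancel : ∀ {A : Set} (a? : Dec A) {p q} →
                     A → indicator a? * p ≡ indicator a? * q → p ≡ q
indicator-*-cancel (yes _) {p} {q} _ eq = trans (sym (*-identityˡ p)) (trans eq (*-identityˡ q))
indicator-*-cancel (no ¬a) a _ = contradiction a ¬a

module _ {d N : ℕ} (P : LatticeSimplePolytope d N) where
  open LatticeSimplePolytope P

  module FacetIntersection {S : Fin N → Set} (S? : ∀ i → Dec (S i)) where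

    weight : Fin N → ℚ
    weight i = indicator (S? i)

    a : ℚ^ d
    a = linearCombination weight (cast ∘ η)

    b : ℚ
    b = ∑ (λ i → weight i * c i)

    a·x≡∑ : ∀ x → a · x ≡ ∑ (λ i → weight i * (cast (η i) · x))
    a·x≡∑ = linearCombination-· weight (cast ∘ η)

    weighted-≤ : ∀ {x} → InP x → ∀ i → weight i * c i ≤ weight i * (cast (η i) · x)
    weighted-≤ x∈P i = indicator-*-mono-≤ (S? i) (x∈P i)

    b≤a·x : ∀ {x} → InP x → b ≤ a · x
    b≤a·x {x} x∈P = subst (b ≤_) (sym (a·x≡∑ x)) (∑-mono-≤ (weighted-≤ x∈P))

    OnH⇒a·x≡b : ∀ {x} → (∀ i → S i → OnH i x) → a · x ≡ b
    OnH⇒a·x≡b {x} x∈H = trans (a·x≡∑ x) (∑-cong λ i → indicator-*-cong (S? i) (x∈H i))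

    a·x≡b⇒OnH : ∀ {x} → InP x → a · x ≡ b → ∀ i → S i → OnH i x
    a·x≡b⇒OnH {x} x∈P a·x≡b i Si =
      sym (indicator-*-cancel (S? i) Si (∑-mono-≤-equality (weighted-≤ x∈P) b≡∑ i))
      where
      b≡∑ : b ≡ ∑ (λ i → weight i * (cast (η i) · x))
      b≡∑ = trans (sym a·x≡b) (a·x≡∑ x)

    face : (y : ℚ^ d) → InP y → (∀ i → S i → OnH i y) → Face P
    face y y∈P y∈H = record
      { a = a ; b = b ; valid = λ _ → b≤a·x ; nonempty = y , y∈P , OnH⇒a·x≡b y∈H }

  module _ (F : Face P) where

    DualBasis-diag : ∀ {α j} → DualBasis P F α → J P F j → cast (η j) · α j ≡ 1ℚ
    DualBasis-diag {α = α} {j} (_ , diag , _) Jj = trans (·-comm (cast (η j)) (α j)) (diag j j Jj Jj refl)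

    DualBasis-offdiag : ∀ {α i j} → DualBasis P F α → J P F j →
                        J P F i → i ≢ j → cast (η i) · α j ≡ 0ℚ
    DualBasis-offdiag {α = α} {i} {j} (_ , _ , offdiag) Jj Ji i≢j =
      trans (·-comm (cast (η i)) (α j)) (offdiag j i Jj Ji (i≢j ∘ sym))

    onFacet : ∀ {i x} → J P F i → InFace P F x → OnH i x
    onFacet Ji x∈F = Ji _ (AffineSpan-⊇ x∈F)

    StrictOff : Fin N → ℚ^ d → Set
    StrictOff i x = ¬ J P F i → c i < cast (η i) · x

    InFace-midpoint : ∀ {x y} → InFace P F x → InFace P F y → InFace P F (midpoint x y)
    InFace-midpoint {x} {y} (x∈P , a·x≡b) (y∈P , a·y≡b) =
        (λ i → subst (c i ≤_) (sym (·-midpoint (cast (η i)) x y)) (≤-midpoint (x∈P i) (y∈P i)))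
      , trans (·-midpoint (Face.a F) x y)
              (trans (cong₂ (λ p q → ½ * (p + q)) a·x≡b a·y≡b) (½*[p+p]≡p (Face.b F)))

    StrictOff-midpointˡ : ∀ {i x y} → StrictOff i x → InP y → StrictOff i (midpoint x y)
    StrictOff-midpointˡ {i} {x} {y} x-off y∈P ¬Ji =
      subst (c i <_) (sym (·-midpoint (cast (η i)) x y)) (<-midpointˡ (x-off ¬Ji) (y∈P i))

    StrictOff-midpointʳ : ∀ {i x y} → InP x → StrictOff i y → StrictOff i (midpoint x y)
    StrictOff-midpointʳ {i} {x} {y} x∈P y-off ¬Ji =
      subst (c i <_) (sym (·-midpoint (cast (η i)) x y)) (<-midpointʳ (x∈P i) (y-off ¬Ji))

    combineStrictOff : ∀ {n} (σ : Fin n → Fin N) →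
                       (∀ m → ∃ λ x → InFace P F x × StrictOff (σ m) x) →
                       ∃ λ x → InFace P F x × ∀ m → StrictOff (σ m) x
    combineStrictOff {zero}  σ _   = proj₁ (Face.nonempty F) , proj₂ (Face.nonempty F) , λ ()
    combineStrictOff {suc n} σ pts =
      let x , x∈F , x-off = pts zero
          z , z∈F , z-off = combineStrictOff (σ ∘ suc) (pts ∘ suc)
      in  midpoint x z
        , InFace-midpoint x∈F z∈F
        , λ { zero    → StrictOff-midpointˡ x-off (proj₁ z∈F)
            ; (suc m) → StrictOff-midpointʳ (proj₁ x∈F) (z-off m) }

    strictOffWitness : ∀ i → ¬ ¬ (∃ λ x → InFace P F x × StrictOff i x)
    strictOffWitness i ∄x = ∄x (proj₁ (Face.nonempty F) , proj₂ (Face.nonempty F) , contradiction Ji)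
      where
      F⊆Hᵢ : ∀ {x} → InFace P F x → OnH i x
      F⊆Hᵢ {x} x∈F = decidable-stable (_ ≟ c i) λ x∉Hᵢ →
        ∄x (x , x∈F , λ _ → ≤∧≢⇒< (proj₁ x∈F i) (x∉Hᵢ ∘ sym))
      Ji : J P F i
      Ji _ = AffineSpan-⊆-hyperplane (cast (η i)) (c i) F⊆Hᵢ

    relativeInteriorPoint : ¬ ¬ (∃ λ x → InFace P F x × ∀ i → StrictOff i x)
    relativeInteriorPoint = ¬¬-map (combineStrictOff id) (¬¬-∀-Fin strictOffWitness)

    module _ (J? : ∀ i → Dec (J P F i)) where

      ·-DualBasis : ∀ {s : Fin N → ℚ} → (∀ i → ¬ J P F i → s i ≡ 0ℚ) →
                    ∀ {α j} → DualBasis P F α → J P F j →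
                    linearCombination s (cast ∘ η) · α j ≡ s j
      ·-DualBasis {s} s-off {α} {j} dual Jj = begin
        linearCombination s (cast ∘ η) · α j   ≡⟨ linearCombination-· s (cast ∘ η) (α j) ⟩
        ∑ (λ i → s i * (cast (η i) · α j))    ≡⟨ ∑-single (λ i → s i * (cast (η i) · α j)) j vanishes ⟩
        s j * (cast (η j) · α j)              ≡⟨ cong (s j *_) (DualBasis-diag dual Jj) ⟩
        s j * 1ℚ                              ≡⟨ *-identityʳ (s j) ⟩
        s j                                   ∎
        where
        open ≡-Reasoning
        vanishes : ∀ i → i ≢ j → s i * (cast (η i) · α j) ≡ 0ℚ
        vanishes i i≢j with J? i
        ... | yes Ji = trans (cong (s i *_) (DualBasis-offdiag dual Jj Ji i≢j)) (*-zeroʳ (s i))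
        ... | no ¬Ji = trans (cong (_* (cast (η i) · α j)) (s-off i ¬Ji)) (*-zeroˡ (cast (η i) · α j))

      integralCoefficient⇒InImage : ∀ {G γ} (s : Fin N → ℚ) → (∀ i → ¬ J P F i → s i ≡ 0ℚ) →
                                    cast γ ≗ linearCombination s (cast ∘ η) →
                                    ∀ {j k} → J P F j → s j ≡ toℚ k →
                                    (∀ i → J P F i → i ≢ j → J P G i) → InImage P F G γ
      integralCoefficient⇒InImage {G} {γ} s s-off γ≗ {j} {k} Jj sⱼ≡k J-G =
        n , n-off , r , r-off , γ-nη≗rη
        where
        n : Fin N → ℤ
        n i with i ≟ᶠ j
        ... | yes _ = k
        ... | no  _ = ℤ.0ℤ

        n-off : ∀ i → ¬ J P F i → n i ≡ ℤ.0ℤ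
        n-off i ¬Ji with i ≟ᶠ j
        ... | yes refl = contradiction Jj ¬Ji
        ... | no  _    = refl

        r : Fin N → ℚ
        r i = s i - toℚ (n i)

        r-off : ∀ i → ¬ J P G i → r i ≡ 0ℚ
        r-off i ¬JGi with i ≟ᶠ j
        ... | yes refl = trans (cong (_- toℚ k) sⱼ≡k) (+-inverseʳ (toℚ k))
        ... | no  i≢j with J? i
        ...   | yes Ji  = contradiction (J-G i Ji i≢j) ¬JGi
        ...   | no  ¬Ji = cong (_- 0ℚ) (s-off i ¬Ji)

        γ-nη≗rη : ∀ l → toℚ (γ l) - ∑ (λ i → toℚ (n i) * toℚ (η i l)) ≡
                        ∑ (λ i → r i * toℚ (η i l))
        γ-nη≗rη l = begin
          toℚ (γ l) - ∑ (λ i → toℚ (n i) * toℚ (η i l))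
            ≡⟨ cong (_- ∑ (λ i → toℚ (n i) * toℚ (η i l))) (γ≗ l) ⟩
          ∑ (λ i → s i * toℚ (η i l)) - ∑ (λ i → toℚ (n i) * toℚ (η i l))
            ≡⟨ sym (∑-distrib-- (λ i → s i * toℚ (η i l)) (λ i → toℚ (n i) * toℚ (η i l))) ⟩
          ∑ (λ i → s i * toℚ (η i l) - toℚ (n i) * toℚ (η i l))
            ≡⟨ ∑-cong (λ i → *-distribʳ-- (s i) (toℚ (n i)) (toℚ (η i l))) ⟩
          ∑ (λ i → r i * toℚ (η i l))
            ∎
          where
          open ≡-Reasoning
          *-distribʳ-- : ∀ p q e → p * e - q * e ≡ (p - q) * e
          *-distribʳ-- = solve 3 (λ p q e → p :* e :- q :* e := (p :- q) :* e) refl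

      module Coarsening (x₀ : ℚ^ d) (x₀∈F : InFace P F x₀) (x₀-off : ∀ i → StrictOff i x₀)
                        {j : Fin N} (Jj : J P F j) (u : ℚ^ d) (ηⱼ·u≡1 : cast (η j) · u ≡ 1ℚ)
                        (ηᵢ·u≡0 : ∀ {i} → J P F i → i ≢ j → cast (η i) · u ≡ 0ℚ) where

        t : Fin N → ℚ
        t i = cast (η i) · u

        0≤t : ∀ {i} → J P F i → 0ℚ ≤ t i
        0≤t {i} Ji with i ≟ᶠ j
        ... | yes refl = subst (0ℚ ≤_) (sym ηⱼ·u≡1) (nonNegative⁻¹ 1ℚ)
        ... | no  i≢j  = ≤-reflexive (sym (ηᵢ·u≡0 Ji i≢j))

        ·-ray : ∀ i e → cast (η i) · (x₀ +ᵛ e *ᵛ u) ≡ cast (η i) · x₀ + e * t i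
        ·-ray i e = trans (·-distribˡ-+ᵛ (cast (η i)) x₀ (e *ᵛ u))
                          (cong (cast (η i) · x₀ +_) (·-*ᵛ (cast (η i)) e u))

        rayInP : ∀ i → HoldsNear0⁺ (λ e → c i ≤ cast (η i) · x₀ + e * t i)
        rayInP i with J? i
        ... | yes Ji  = 1ℚ , positive⁻¹ 1ℚ , λ e 0≤e _ →
                          subst (λ z → c i ≤ z + e * t i) (sym (onFacet Ji x₀∈F))
                                (p≤p+q*r (c i) 0≤e (0≤t Ji))
        ... | no  ¬Ji = <-robust (t i) (x₀-off i ¬Ji)

        ε : ℚ
        ε = proj₁ (∀-HoldsNear0⁺ rayInP)

        0<ε : 0ℚ < ε
        0<ε = proj₁ (proj₂ (∀-HoldsNear0⁺ rayInP))

        y : ℚ^ d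
        y = x₀ +ᵛ ε *ᵛ u

        y∈P : InP y
        y∈P i = subst (c i ≤_) (sym (·-ray i ε))
                      (proj₂ (proj₂ (∀-HoldsNear0⁺ rayInP)) ε (<⇒≤ 0<ε) ≤-refl i)

        Kept : Fin N → Set
        Kept i = J P F i × i ≢ j

        y∈Hₖ : ∀ i → Kept i → OnH i y
        y∈Hₖ i (Ji , i≢j) = begin
          cast (η i) · y              ≡⟨ ·-ray i ε ⟩
          cast (η i) · x₀ + ε * t i   ≡⟨ cong₂ _+_ (onFacet Ji x₀∈F) (cong (ε *_) (ηᵢ·u≡0 Ji i≢j)) ⟩
          c i + ε * 0ℚ                ≡⟨ cong (c i +_) (*-zeroʳ ε) ⟩
          c i + 0ℚ                    ≡⟨ +-identityʳ (c i) ⟩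
          c i                         ∎
          where open ≡-Reasoning

        y∉Hⱼ : ¬ OnH j y
        y∉Hⱼ y∈Hⱼ = <-irrefl (sym y∈Hⱼ) (begin-strict
          c j                         ≡⟨ sym (+-identityʳ (c j)) ⟩
          c j + 0ℚ                    <⟨ +-monoʳ-< (c j) 0<ε ⟩
          c j + ε                     ≡⟨ cong₂ _+_ (sym (onFacet Jj x₀∈F)) (sym ε*tⱼ≡ε) ⟩
          cast (η j) · x₀ + ε * t j   ≡⟨ sym (·-ray j ε) ⟩
          cast (η j) · y              ∎)
          where
          open ≤-Reasoning
          ε*tⱼ≡ε : ε * t j ≡ ε
          ε*tⱼ≡ε = trans (cong (ε *_) ηⱼ·u≡1) (*-identityʳ ε)

        open FacetIntersection (λ i → J? i ×-dec ¬? (i ≟ᶠ j))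

        coarser : Face P
        coarser = face y y∈P y∈Hₖ

        J-coarser : ∀ i → J P F i → i ≢ j → J P coarser i
        J-coarser i Ji i≢j _ = AffineSpan-⊆-hyperplane (cast (η i)) (c i)
          λ (x∈P , a·x≡b) → a·x≡b⇒OnH x∈P a·x≡b i (Ji , i≢j)

        F⊆coarser : ∀ {x} → InFace P F x → InFace P coarser x
        F⊆coarser x∈F = proj₁ x∈F , OnH⇒a·x≡b λ i (Ji , _) → onFacet Ji x∈F

        F⊊coarser : StrictSub P F coarser
        F⊊coarser = (λ _ → AffineSpan-mono F⊆coarser)
                  , λ coarser⊆F → y∉Hⱼ (Jj y (coarser⊆F y (AffineSpan-⊇ (y∈P , OnH⇒a·x≡b y∈Hₖ))))

claim85 : ∀ {d N : ℕ} (P : LatticeSimplePolytope d N) (F : Face P) (γ : ℤ^ d)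
            → InΓb P F γ
            → (α : Fin N → ℚ^ d) → DualBasis P F α
            → (j : Fin N) → J P F j
            → ¬ IsInteger (cast γ · α j)
claim85 P F γ ((s , s-off , γ≗) , γ∉coarser) α dual j Jj (k , γ·αⱼ≡k) =
  ¬¬-∀-Fin (λ _ → ¬¬-excluded-middle) λ J? →
  relativeInteriorPoint P F λ (x₀ , x₀∈F , x₀-off) →
  let open Coarsening P F J? x₀ x₀∈F x₀-off Jj (α j)
                      (DualBasis-diag P F dual Jj) (DualBasis-offdiag P F dual Jj)
      γ·αⱼ≡sⱼ = trans (·-congˡ (α j) γ≗) (·-DualBasis P F J? s-off dual Jj)
      sⱼ≡k    = trans (sym γ·αⱼ≡sⱼ) γ·αⱼ≡k
  in  γ∉coarser coarser F⊊coarser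
        (integralCoefficient⇒InImage P F J? {coarser} {γ} s s-off γ≗ {k = k} Jj sⱼ≡k J-coarser)
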